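{- Let $H$ be a finite digraph possibly with loops, $D$ a finite $H$-colored digraph without loops and without isolated vertices, and $\xi=\{C_1,\dots,C_k\}$ ($k\ge2$) a partition of $V(H)$ such that for every $i$ the set $A_i=\{a\in A(D):c(a)\in C_i\}$ is nonempty and $G_i=D[A_i]$ is transitive by $H$-paths. Let $\{\xi_1,\xi_2\}$ be a partition of $\xi$ and, for $i\in\{1,2\}$, let $D_i$ be the spanning subdigraph of $D$ with $A(D_i)=\{a\in A(D):c(a)\in C_j\text{ for some }C_j\in\xi_i\}$. Let $\{u,z,x,w\}\subseteq V(D)$ (where $u$ may equal $x$). Suppose that: (1) for every $i\in\{1,2\}$ and every cycle $\gamma$ contained in $D_i$ there exists $C_m\in\xi_i$ such that $\gamma$ is contained in $G_m$; (2) for every $i\in\{1,2\}$ and every $H$-walk $P$ contained in $D_i$ there exists $C_{m'}\in\xi_i$ such that $P$ is contained in $G_{m'}$; (3) there exist a $uz$-$H$-path $\alpha_1$ contained in $D_1$, a $zw$-$H$-path $\alpha_2$ contained in $D$, and a $wx$-$H$-path $\alpha_3$ contained in $D_2$, such that there are $H$-obstructions on $z$ and on $w$ with respect to $\alpha_1\cup\alpha_2\cup\alpha_3$; (4) if $(a,b)\in A(\mathscr{C}_C(D))$ is a $\xi_1\xi_2$-arc or a $\xi_2\xi_1$-arc, then $(a,b)\notin A(H)$. If there is no $uw$-$H$-path in $D$, no $zx$-$H$-path in $D$, and no $zu$-$H$-path in $D$, then either there exists a $ux$-path which is a $(\xi_1,\xi,\xi_2)$-$H$-subdivision of $\overrightarrow{P_3}$,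 or there exists a $(\xi_1,\xi,\xi_2)$-$H$-subdivision of $\overrightarrow{C_3}$ in $D$.
   Context: Paths, walks and cycles are directed; a path has pairwise distinct vertices. $D$ is $H$-colored if it has an arc coloring $c:A(D)\to V(H)$. A walk $(v_0,\dots,v_n)$ is an $H$-walk if $(c(v_0,v_1),\dots,c(v_{n-1},v_n))$ is a walk in $H$ (a single arc is an $H$-walk); an $H$-path is a path that is an $H$-walk. $D[A]$ for an arc set $A$ is the subdigraph with arc set $A$ and vertex set the ends of arcs in $A$. A subdigraph $G$ is transitive by $H$-paths if an $xy$-$H$-path contained in $G$ and a $yz$-$H$-path contained in $G$ imply an $xz$-$H$-path contained in $G$. On a walk $(v_0,\dots,v_n)$ there is an $H$-obstruction on $v_i$ if $(c(v_{i-1},v_i),c(v_i,v_{i+1}))\notin A(H)$ (indices modulo $n$ for closed walks). The color-class digraph $\mathscr{C}_C(D)$ has as vertices the colors appearing on arcs of $D$, with $(i,j)$ an arc (loops allowed) iff there are arcs $(u,v),(v,w)$ in $D$ colored $i$ and $j$. A $\xi_1\xi_2$-arc is an arc $(a,b)$ with $a$ in some member of $\xi_1$ and $b$ in some member of $\xi_2$; $\xi_2\xi_1$-arcs symmetrically. $(x,W,y)$ denotes the subwalk of $W$ from $x$ to $y$. A cycle $W=(u_0,\dots,u_l=v_0,\dots,v_m=w_0,\dots,w_n=u_0)$ is a $(\xi_1,\xi,\xi_2)$-$H$-subdivision of $\overrightarrow{C_3}$ if $(u_0,W,u_l)$ is an $H$-path contained in $D_1$, $(v_0,W,v_m)$ is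 an $H$-path in $D$, $(w_0,W,w_n)$ is an $H$-path contained in $D_2$, and there are $H$-obstructions on $u_0,v_0,w_0$ with respect to $W$. A path $P=(u_0,\dots,u_l=v_0,\dots,v_m=w_0,\dots,w_n)$ is a $(\xi_1,\xi,\xi_2)$-$H$-subdivision of $\overrightarrow{P_3}$ if $(u_0,P,u_l)$ is an $H$-path contained in $D_1$, $(v_0,P,v_m)$ is an $H$-path in $D$, $(w_0,P,w_n)$ is an $H$-path contained in $D_2$, and there are $H$-obstructions on $v_0$ and $w_0$ with respect to $P$. -}

module Defs where

open import Data.Nat using (ℕ; zero; suc)
open import Data.Bool using (Bool; true; false)
open import Data.Fin using (Fin)
open import Data.List using (List; []; _∷_; _++_; map)
open import Data.List.Relation.Unary.All using (All)
open import Data.List.Relation.Unary.Linked using (Linked)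
open import Data.List.Relation.Unary.Unique.Propositional using (Unique)
open import Data.Product using (Σ; ∃; _×_; _,_; proj₁; proj₂)
open import Data.Empty using (⊥)
open import Data.Unit using (⊤)
open import Relation.Binary.PropositionalEquality using (_≡_; _≢_)
open import Relation.Nullary using (¬_)

lastOf : {A : Set} → A → List A → A
lastOf x [] = x
lastOf x (y ∷ ys) = lastOf y ys

-- ConsecAt xs i a b : the entries of xs at positions i and i+1 (0-based) are a and b
ConsecAt : {A : Set} → List A → ℕ → A → A → Set
ConsecAt (x ∷ y ∷ xs) zero a b = (x ≡ a) × (y ≡ b)
ConsecAt (x ∷ xs) (suc i) a b = ConsecAt xs i a b
ConsecAt _ _ _ _ = ⊥

-- c_n ∷ c_1 ∷ ... ∷ c_n ∷ c_1  (cyclic padding of a colour sequence of a closed walk)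
wrap : {A : Set} → List A → List A
wrap [] = []
wrap (a ∷ as) = lastOf a as ∷ ((a ∷ as) ++ (a ∷ []))

data Side : Set where
  one two : Side

-- The setting:
--  D : digraph on Fin n with arc relation DA (Bool adjacency matrix),
--  H : digraph (loops allowed) on Fin h with arc relation HA,
--  c : arc colouring of D (only its values on arcs of D matter),
--  cls : the partition ξ = {C_1..C_k} of V(H), colour a lies in C_(cls a),
--  side : the partition {ξ₁ , ξ₂} of ξ, C_m ∈ ξ₁ iff side m ≡ one.
module Setting {n h k : ℕ}
  (DA : Fin n → Fin n → Bool) (HA : Fin h → Fin h → Bool)
  (c : Fin n → Fin n → Fin h) (cls : Fin h → Fin k) (side : Fin k → Side) where

  V : Set
  V = Fin n

  Arc : V → V → Set
  Arc u v = DA u v ≡ true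

  HArc : Fin h → Fin h → Set
  HArc a b = HA a b ≡ true

  pairs : List V → List (V × V)
  pairs (x ∷ y ∷ vs) = (x , y) ∷ pairs (y ∷ vs)
  pairs _ = []

  colors : List V → List (Fin h)
  colors vs = map (λ p → c (proj₁ p) (proj₂ p)) (pairs vs)

  -- subdigraphs of D are given by a predicate selecting arcs of D;
  -- a walk (vertex list) is contained in it iff each traversed pair is an arc of D
  -- selected by the predicate
  ContainedIn : (V → V → Set) → List V → Set
  ContainedIn P vs = All (λ p → Arc (proj₁ p) (proj₂ p) × P (proj₁ p) (proj₂ p)) (pairs vs)

  -- arc selectors: D itself, D_s (spanning, colours in classes of ξ_s), G_m = D[A_m]
  InD : V → V → Set
  InD u v = ⊤

  InDi : Side → V → V → Set
  InDi s u v = side (cls (c u v)) ≡ s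

  InG : Fin k → V → V → Set
  InG m u v = cls (c u v) ≡ m

  IsHWalk : List V → Set
  IsHWalk vs = Linked HArc (colors vs)

  HPathIn : (V → V → Set) → V → List V → V → Set
  HPathIn P x rest y =
    (lastOf x rest ≡ y) × Unique (x ∷ rest) × ContainedIn P (x ∷ rest) × IsHWalk (x ∷ rest)

  ExHPath : (V → V → Set) → V → V → Set
  ExHPath P x y = Σ (List V) (λ rest → HPathIn P x rest y)

  CycleIn : (V → V → Set) → V → List V → Set
  CycleIn P x rest = (rest ≢ []) × (lastOf x rest ≡ x) × Unique rest × ContainedIn P (x ∷ rest)

  TransByHPaths : (V → V → Set) → Set
  TransByHPaths P = ∀ x y z → ExHPath P x y → ExHPath P y z → ExHPath P x z

  OpenObst : List (Fin h) → ℕ → Set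
  OpenObst cs zero = ⊥
  OpenObst cs (suc i) = ∃ λ a → ∃ λ b → ConsecAt cs i a b × ¬ HArc a b

  -- H-obstruction on the vertex with index i (0 ≤ i ≤ length, indices mod length)
  -- of a closed walk with colour sequence cs
  ClosedObst : List (Fin h) → ℕ → Set
  ClosedObst cs i = ∃ λ a → ∃ λ b → ConsecAt (wrap cs) i a b × ¬ HArc a b

  CCArc : Fin h → Fin h → Set
  CCArc a b = ∃ λ u → ∃ λ v → ∃ λ w →
    Arc u v × Arc v w × (c u v ≡ a) × (c v w ≡ b)

{-# OPTIONS --safe #-}
module Submission where

-- Condition (4) forces consecutive arcs of an H-walk onto the same side, so α₂ lies in D₁ or in
-- D₂, and it puts an H-obstruction wherever a D₁-arc is followed by a D₂-arc or vice versa. The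
-- missing H-paths give the remaining obstructions: a piece of α₁ continued along α₂ without an
-- obstruction would be a uw-H-path, and a piece of α₂ continued along α₃ a zx- or zu-H-path.
-- Following α₁ to its first vertex on α₂ (or on α₃), then α₂ to its first vertex on α₃, and
-- closing with the rest of α₃, the three pieces form a ux-path, or a cycle through u or x when
-- α₁ meets α₃ there.

open import Defs
open import Data.Nat using (ℕ; zero; suc; _≤_; _+_)
open import Data.Bool using (Bool; true; false)
open import Data.Bool.Properties using () renaming (_≟_ to _≟ᵇ_)
open import Data.Fin using (Fin; _≟_)
open import Data.List using (List; []; _∷_; _++_; _∷ʳ_; length; map)
open import Data.List.Properties
  using (∷-injective; ++-assoc; ++-identityʳ; ++-cancelˡ; ++-conicalˡ; length-++; map-++)
open import Data.List.Membership.Propositional using (_∈_; _∉_)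
open import Data.List.Membership.Propositional.Properties using (∈-++⁺ˡ; ∈-++⁺ʳ; ∈-++⁻)
import Data.List.Membership.DecPropositional as DecMembership
open import Data.List.Relation.Binary.Disjoint.Propositional using (Disjoint)
open import Data.List.Relation.Binary.Subset.Propositional using (_⊆_)
open import Data.List.Relation.Binary.Subset.Propositional.Properties using (∷⁺ʳ)
open import Data.List.Relation.Unary.All as All using (All; []; _∷_)
import Data.List.Relation.Unary.All.Properties as All
open import Data.List.Relation.Unary.AllPairs using ([]; _∷_)
open import Data.List.Relation.Unary.Any using (here; there)
import Data.List.Relation.Unary.First as First
open import Data.List.Relation.Unary.First.Properties using (toView)
open import Data.List.Relation.Unary.Linked as Linked using (Linked; []; [-]; _∷_)
open import Data.List.Relation.Unary.Unique.Propositional using (Unique)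
import Data.List.Relation.Unary.Unique.Propositional.Properties as Unique
open import Data.Product using (∃; ∃₂; _×_; _,_; proj₁; proj₂)
open import Data.Sum as Sum using (_⊎_; inj₁; inj₂)
open import Data.Empty using (⊥-elim)
open import Data.Unit using (tt)
open import Function using (id; _∘_)
open import Relation.Binary.Definitions using (DecidableEquality)
open import Relation.Binary.PropositionalEquality
open import Relation.Nullary using (¬_; Dec; yes; no)
open import Relation.Nullary.Decidable using (toSum)

module _ {A : Set} where

  lastOf-++ : (x : A) (r s : List A) → lastOf x (r ++ s) ≡ lastOf (lastOf x r) s
  lastOf-++ x [] s = refl
  lastOf-++ x (y ∷ r) s = lastOf-++ y r s

  lastOf-∷ʳ : (x : A) (r : List A) (v : A) → lastOf x (r ∷ʳ v) ≡ v
  lastOf-∷ʳ x r v = lastOf-++ x r (v ∷ [])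

  lastOf-∈ : (x : A) (r : List A) → lastOf x r ∈ x ∷ r
  lastOf-∈ x [] = here refl
  lastOf-∈ x (y ∷ r) = there (lastOf-∈ y r)

  ∈⇒split : {x v : A} {r : List A} → v ∈ x ∷ r → ∃₂ λ r₀ r₁ → r ≡ r₀ ++ r₁ × lastOf x r₀ ≡ v
  ∈⇒split {r = r} (here refl) = [] , r , refl , refl
  ∈⇒split {r = y ∷ r} (there v∈) with ∈⇒split v∈
  ... | r₀ , r₁ , refl , refl = y ∷ r₀ , r₁ , refl , refl

  split-unique : {x : A} (r₀ r₁ s₀ s₁ : List A) → Unique (x ∷ r₀ ++ r₁) →
    r₀ ++ r₁ ≡ s₀ ++ s₁ → lastOf x r₀ ≡ lastOf x s₀ → r₀ ≡ s₀
  split-unique [] r₁ [] s₁ _ _ _ = refl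
  split-unique [] r₁ (y ∷ s₀) s₁ (x∉ ∷ _) eq e =
    ⊥-elim (All.lookup x∉ (subst (_ ∈_) (sym eq) (∈-++⁺ˡ (lastOf-∈ y s₀))) e)
  split-unique (y ∷ r₀) r₁ [] s₁ (x∉ ∷ _) _ e = ⊥-elim (All.lookup x∉ (∈-++⁺ˡ (lastOf-∈ y r₀)) (sym e))
  split-unique (y ∷ r₀) r₁ (_ ∷ s₀) s₁ (_ ∷ u) eq e with ∷-injective eq
  ... | refl , eq′ = cong (y ∷_) (split-unique r₀ r₁ s₀ s₁ u eq′ e)

  Unique-∷ : {v : A} {s : List A} → v ∉ s → Unique s → Unique (v ∷ s)
  Unique-∷ {s = s} v∉s u = All.¬Any⇒All¬ s v∉s ∷ u

  Unique-++⁻ : (xs : List A) {ys : List A} → Unique (xs ++ ys) → Unique xs × Unique ys × Disjoint xs ys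
  Unique-++⁻ [] u = [] , u , λ ()
  Unique-++⁻ (x ∷ xs) (x∉ ∷ u) with Unique-++⁻ xs u
  ... | uxs , uys , xs#ys = All.++⁻ˡ xs x∉ ∷ uxs , uys , λ where
    (here refl , v∈ys) → All.lookup (All.++⁻ʳ xs x∉) v∈ys refl
    (there v∈xs , v∈ys) → xs#ys (v∈xs , v∈ys)

  All∉⇒Disjoint : {xs ys : List A} → All (_∉ ys) xs → Disjoint xs ys
  All∉⇒Disjoint none (v∈xs , v∈ys) = All.lookup none v∈xs v∈ys

  Disjoint-⊆ : {xs xs′ ys ys′ : List A} → xs′ ⊆ xs → ys′ ⊆ ys → Disjoint xs ys → Disjoint xs′ ys′
  Disjoint-⊆ xs′⊆ ys′⊆ xs#ys (v∈xs′ , v∈ys′) = xs#ys (xs′⊆ v∈xs′ , ys′⊆ v∈ys′)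

  Disjoint-++ : {xs ys zs : List A} → Disjoint xs ys → Disjoint xs zs → Disjoint xs (ys ++ zs)
  Disjoint-++ {ys = ys} xs#ys xs#zs (v∈xs , v∈ys++zs) with ∈-++⁻ ys v∈ys++zs
  ... | inj₁ v∈ys = xs#ys (v∈xs , v∈ys)
  ... | inj₂ v∈zs = xs#zs (v∈xs , v∈zs)

  Disjoint-∷ʳ : {xs ys : List A} {v : A} → Disjoint xs ys → v ∉ ys → Disjoint (xs ∷ʳ v) ys
  Disjoint-∷ʳ {xs} xs#ys v∉ys (t∈ , t∈ys) with ∈-++⁻ xs t∈
  ... | inj₁ t∈xs = xs#ys (t∈xs , t∈ys)
  ... | inj₂ (here refl) = v∉ys t∈ys

  ∷ʳ≢[] : (T : List A) (v : A) → T ∷ʳ v ≢ []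
  ∷ʳ≢[] [] v ()
  ∷ʳ≢[] (_ ∷ _) v ()

  Linked-++⁻ : {R : A → A → Set} (xs : List A) {ys : List A} →
    Linked R (xs ++ ys) → Linked R xs × Linked R ys
  Linked-++⁻ [] l = [] , l
  Linked-++⁻ (x ∷ []) l = [-] , Linked.tail l
  Linked-++⁻ (x ∷ y ∷ xs) (r ∷ l) with Linked-++⁻ (y ∷ xs) l
  ... | lxs , lys = r ∷ lxs , lys

  ConsecAt-++ : (xs ys : List A) (i : ℕ) {a b : A} → ConsecAt xs i a b → ConsecAt (xs ++ ys) i a b
  ConsecAt-++ (x ∷ y ∷ xs) ys zero p = p
  ConsecAt-++ (x ∷ y ∷ xs) ys (suc i) p = ConsecAt-++ (y ∷ xs) ys i p

  data FirstIn (S : List A) : List A → Set where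
    firstIn : (T : List A) (v : A) (r : List A) → All (_∉ S) T → v ∈ S → FirstIn S ((T ∷ʳ v) ++ r)

  ∈-∷ʳ-++ : (T : List A) {v : A} (r : List A) → v ∈ (T ∷ʳ v) ++ r
  ∈-∷ʳ-++ T r = ∈-++⁺ˡ (∈-++⁺ʳ T (here refl))

  ∷ʳ-++-≢head : {x v : A} (T r : List A) → Unique (x ∷ (T ∷ʳ v) ++ r) → v ≢ x
  ∷ʳ-++-≢head T r u refl = Unique.Unique[x∷xs]⇒x∉xs u (∈-∷ʳ-++ T r)

  onlyHit : {S : List A} {u t : A} (T : List A) (v : A) (r : List A) → All (_∉ S) (u ∷ T) → All (_∉ S) r →
    t ∈ u ∷ (T ∷ʳ v) ++ r → t ∈ S → t ≡ v
  onlyHit T v r uT∉S r∉S (here refl) t∈S = ⊥-elim (All.head uT∉S t∈S)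
  onlyHit T v r uT∉S r∉S (there t∈) t∈S with ∈-++⁻ (T ∷ʳ v) t∈
  ... | inj₂ t∈r = ⊥-elim (All.lookup r∉S t∈r t∈S)
  ... | inj₁ t∈Tv with ∈-++⁻ T t∈Tv
  ...   | inj₁ t∈T = ⊥-elim (All.lookup (All.tail uT∉S) t∈T t∈S)
  ...   | inj₂ (here eq) = eq

module _ {A : Set} (_≟_ : DecidableEquality A) where
  open DecMembership _≟_ using (_∈?_)

  firstIn? : (S r : List A) → FirstIn S r ⊎ All (_∉ S) r
  firstIn? S r with First.first (Sum.swap ∘ toSum ∘ (_∈? S)) r
  ... | inj₂ none = inj₂ none
  ... | inj₁ hit with toView hit
  ...   | First._++_∷_ {xs = T} {y = v} avoid v∈S r′ =
    inj₁ (subst (FirstIn S) (++-assoc T (v ∷ []) r′) (firstIn T v r′ avoid v∈S))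

  firstIn-lastOf : (S : List A) (x : A) (r : List A) → x ∉ S → lastOf x r ∈ S → FirstIn S r
  firstIn-lastOf S x r x∉S last∈S with firstIn? S r
  ... | inj₁ hit = hit
  ... | inj₂ none with lastOf-∈ x r
  ...   | here eq = ⊥-elim (x∉S (subst (_∈ S) eq last∈S))
  ...   | there last∈r = ⊥-elim (All.lookup none last∈r last∈S)

module _ {n h k : ℕ}
  (DA : Fin n → Fin n → Bool) (HA : Fin h → Fin h → Bool)
  (c : Fin n → Fin n → Fin h) (cls : Fin h → Fin k) (side : Fin k → Side) where

  open Setting DA HA c cls side
  open DecMembership (_≟_ {n}) using (_∈?_)

  pairs-++ : (x : V) (r s : List V) → pairs (x ∷ r ++ s) ≡ pairs (x ∷ r) ++ pairs (lastOf x r ∷ s)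
  pairs-++ x [] s = refl
  pairs-++ x (y ∷ r) s = cong ((x , y) ∷_) (pairs-++ y r s)

  colors-++ : (x : V) (r s : List V) → colors (x ∷ r ++ s) ≡ colors (x ∷ r) ++ colors (lastOf x r ∷ s)
  colors-++ x r s = trans (cong (map _) (pairs-++ x r s)) (map-++ _ (pairs (x ∷ r)) _)

  ContainedIn-++⁻ : ∀ {P} x r s → ContainedIn P (x ∷ r ++ s) →
    ContainedIn P (x ∷ r) × ContainedIn P (lastOf x r ∷ s)
  ContainedIn-++⁻ x r s a = All.++⁻ (pairs (x ∷ r)) (subst (All _) (pairs-++ x r s) a)

  ContainedIn-++⁺ : ∀ {P v} x r s → lastOf x r ≡ v → ContainedIn P (x ∷ r) → ContainedIn P (v ∷ s) →
    ContainedIn P (x ∷ r ++ s)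
  ContainedIn-++⁺ x r s refl a b = subst (All _) (sym (pairs-++ x r s)) (All.++⁺ a b)

  IsHWalk-++⁻ : ∀ x r s → IsHWalk (x ∷ r ++ s) → IsHWalk (x ∷ r) × IsHWalk (lastOf x r ∷ s)
  IsHWalk-++⁻ x r s l = Linked-++⁻ (colors (x ∷ r)) (subst (Linked HArc) (colors-++ x r s) l)

  lastColour : V → V → List V → Fin h
  lastColour x y r = lastOf (c x y) (colors (y ∷ r))

  lastColour-++ : ∀ x y r m s → lastColour x y (r ++ m ∷ s) ≡ lastColour (lastOf y r) m s
  lastColour-++ x y [] m s = refl
  lastColour-++ x y (y′ ∷ r) m s = lastColour-++ y y′ r m s

  lastArc : ∀ {P} x y r → ContainedIn P (x ∷ y ∷ r) →
    ∃ λ t → (Arc t (lastOf y r) × P t (lastOf y r)) × lastColour x y r ≡ c t (lastOf y r)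
  lastArc x y [] (xy ∷ []) = x , xy , refl
  lastArc x y (y′ ∷ r) (_ ∷ a) = lastArc y y′ r a

  IsHWalk-++⁺ : ∀ x y r m s → IsHWalk (x ∷ y ∷ r) → IsHWalk (lastOf y r ∷ m ∷ s) →
    HArc (lastColour x y r) (c (lastOf y r) m) → IsHWalk (x ∷ y ∷ r ++ m ∷ s)
  IsHWalk-++⁺ x y [] m s [-] l turn = turn ∷ l
  IsHWalk-++⁺ x y (y′ ∷ r) m s (h ∷ l₁) l₂ turn = h ∷ IsHWalk-++⁺ y y′ r m s l₁ l₂ turn

  unique : ∀ {P x r y} → HPathIn P x r y → Unique (x ∷ r)
  unique = proj₁ ∘ proj₂

  contained : ∀ {P x r y} → HPathIn P x r y → ContainedIn P (x ∷ r)
  contained = proj₁ ∘ proj₂ ∘ proj₂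

  start∉ : ∀ {P x r y} → HPathIn P x r y → x ∉ r
  start∉ = Unique.Unique[x∷xs]⇒x∉xs ∘ unique

  HPathIn-InD : ∀ {P x r y} → HPathIn P x r y → HPathIn InD x r y
  HPathIn-InD (end , u , a , l) = end , u , All.map (λ (uv , _) → uv , tt) a , l

  HPathIn-split : ∀ {P x v y} r s → lastOf x r ≡ v → HPathIn P x (r ++ s) y →
    HPathIn P x r v × HPathIn P v s y
  HPathIn-split {x = x} r s refl (end , u , a , l)
    with Unique-++⁻ (x ∷ r) u | ContainedIn-++⁻ x r s a | IsHWalk-++⁻ x r s l
  ... | u₁ , u₂ , r#s | a₁ , a₂ | l₁ , l₂ =
    (refl , u₁ , a₁ , l₁) ,
    (trans (sym (lastOf-++ x r s)) end , Unique-∷ (λ v∈s → r#s (lastOf-∈ x r , v∈s)) u₂ , a₂ , l₂)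

  properSuffix : ∀ {P x r y v} → HPathIn P x r y → v ∈ x ∷ r → v ≢ y →
    ∃ λ s → HPathIn P v s y × s ⊆ r × s ≢ []
  properSuffix p v∈ v≢y with ∈⇒split v∈
  ... | r₀ , s , refl , r₀-end = s , suffix , ∈-++⁺ʳ r₀ , λ { refl → v≢y (proj₁ suffix) }
    where suffix = proj₂ (HPathIn-split r₀ s r₀-end p)

  ∉HPathFrom : ∀ {P x r y v} → ¬ ExHPath InD x v → HPathIn P x r y → v ∉ x ∷ r
  ∉HPathFrom no-xv p v∈ with ∈⇒split v∈
  ... | r₀ , r₁ , refl , r₀-end = no-xv (r₀ , HPathIn-InD (proj₁ (HPathIn-split r₀ r₁ r₀-end p)))

  ∉HPathTo : ∀ {P x r y v} → ¬ ExHPath InD v y → HPathIn P x r y → v ∉ x ∷ r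
  ∉HPathTo no-vy p v∈ with ∈⇒split v∈
  ... | r₀ , r₁ , refl , r₀-end = no-vy (r₁ , HPathIn-InD (proj₂ (HPathIn-split r₀ r₁ r₀-end p)))

  -- The H-obstruction at the vertex lastOf x r, which sits at position length r of x ∷ r ++ s.
  ObstructedAt : V → List V → List V → Set
  ObstructedAt x r s = OpenObst (colors (x ∷ r ++ s)) (length r)

  openObst-∷ : ∀ a cs i → OpenObst cs i → OpenObst (a ∷ cs) (suc i)
  openObst-∷ a cs zero ()
  openObst-∷ a [] (suc i) (_ , _ , () , _)
  openObst-∷ a (b ∷ cs) (suc i) o = o

  openObst⇒closedObst : ∀ cs i → OpenObst cs i → ClosedObst cs i
  openObst⇒closedObst (c₀ ∷ cs) (suc i) (a , b , p , ¬ab) =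
    a , b , ConsecAt-++ (c₀ ∷ cs) (c₀ ∷ []) i p , ¬ab

  obstructedAt-∷ : ∀ x y r s → ObstructedAt y r s → ObstructedAt x (y ∷ r) s
  obstructedAt-∷ x y r s = openObst-∷ (c x y) (colors (y ∷ r ++ s)) (length r)

  obstructedAt-++ : ∀ x r r′ s → ObstructedAt (lastOf x r) r′ s → ObstructedAt x (r ++ r′) s
  obstructedAt-++ x [] r′ s o = o
  obstructedAt-++ x (y ∷ r) r′ s o = obstructedAt-∷ x y (r ++ r′) s (obstructedAt-++ y r r′ s o)

  obstructedAt-++-assoc : ∀ a r₁ r₂ r₃ → ObstructedAt a (r₁ ++ r₂) r₃ →
    OpenObst (colors (a ∷ r₁ ++ r₂ ++ r₃)) (length r₁ + length r₂)
  obstructedAt-++-assoc a r₁ r₂ r₃ =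
    subst₂ (λ r i → OpenObst (colors (a ∷ r)) i) (++-assoc r₁ r₂ r₃) (length-++ r₁)

  obstructedAt-drop : ∀ x r r′ s → r′ ≢ [] → ObstructedAt x (r ++ r′) s → ObstructedAt (lastOf x r) r′ s
  obstructedAt-drop x [] r′ s _ o = o
  obstructedAt-drop x (y ∷ []) [] s r′≢[] o = ⊥-elim (r′≢[] refl)
  obstructedAt-drop x (y ∷ []) (m ∷ r′) s _ o = o
  obstructedAt-drop x (y ∷ y′ ∷ r) r′ s r′≢[] o = obstructedAt-drop y (y′ ∷ r) r′ s r′≢[] o

  obstructedAt-head : ∀ x r m s s′ → ObstructedAt x r (m ∷ s) → ObstructedAt x r (m ∷ s′)
  obstructedAt-head x [] m s s′ ()
  obstructedAt-head x (y ∷ []) m s s′ o = o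
  obstructedAt-head x (y ∷ y′ ∷ r) m s s′ o = obstructedAt-head y (y′ ∷ r) m s s′ o

  obstructedAt-prefix : ∀ x r s t t′ → s ≢ [] → ObstructedAt x r (s ++ t) → ObstructedAt x r (s ++ t′)
  obstructedAt-prefix x r [] t t′ s≢[] _ = ⊥-elim (s≢[] refl)
  obstructedAt-prefix x r (m ∷ s) t t′ _ = obstructedAt-head x r m (s ++ t) (s ++ t′)

  obstructedAt-[] : ∀ x r → ¬ ObstructedAt x r []
  obstructedAt-[] x [] ()
  obstructedAt-[] x (y ∷ []) (_ , _ , () , _)
  obstructedAt-[] x (y ∷ y′ ∷ r) o = obstructedAt-[] y (y′ ∷ r) o

  obstructedAt-turn : ∀ x y r m s → ¬ HArc (lastColour x y r) (c (lastOf y r) m) →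
    ObstructedAt x (y ∷ r) (m ∷ s)
  obstructedAt-turn x y [] m s ¬turn = _ , _ , (refl , refl) , ¬turn
  obstructedAt-turn x y (y′ ∷ r) m s ¬turn =
    obstructedAt-∷ x y (y′ ∷ r) (m ∷ s) (obstructedAt-turn y y′ r m s ¬turn)

  IsHWalk-join : ∀ x r s → IsHWalk (x ∷ r) → IsHWalk (lastOf x r ∷ s) →
    ObstructedAt x r s ⊎ IsHWalk (x ∷ r ++ s)
  IsHWalk-join x [] s _ l = inj₂ l
  IsHWalk-join x (y ∷ r) [] l _ = inj₂ (subst (λ t → IsHWalk (x ∷ y ∷ t)) (sym (++-identityʳ r)) l)
  IsHWalk-join x (y ∷ r) (m ∷ s) l₁ l₂ with HA (lastColour x y r) (c (lastOf y r) m) ≟ᵇ true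
  ... | yes turn = inj₂ (IsHWalk-++⁺ x y r m s l₁ l₂ turn)
  ... | no ¬turn = inj₁ (obstructedAt-turn x y r m s ¬turn)

  HPathIn-join : ∀ {P x v y} r s → HPathIn P x r v → HPathIn P v s y → Disjoint (x ∷ r) s →
    ObstructedAt x r s ⊎ HPathIn P x (r ++ s) y
  HPathIn-join {x = x} r s (r-end , u₁ , a₁ , l₁) (s-end , _ ∷ u₂ , a₂ , l₂) r#s
    with IsHWalk-join x r s l₁ (subst (λ v → IsHWalk (v ∷ s)) (sym r-end) l₂)
  ... | inj₁ o = inj₁ o
  ... | inj₂ l =
    inj₂ (trans (lastOf-++ x r s) (subst (λ v → lastOf v s ≡ _) (sym r-end) s-end) ,
          Unique.++⁺ u₁ u₂ r#s , ContainedIn-++⁺ x r s r-end a₁ a₂ , l)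

  obstructedAt-¬ExHPath : ∀ {P Q x v y} r s → ¬ ExHPath InD x y → HPathIn P x r v → HPathIn Q v s y →
    Disjoint (x ∷ r) s → ObstructedAt x r s
  obstructedAt-¬ExHPath r s no-xy X Y r#s with HPathIn-join r s (HPathIn-InD X) (HPathIn-InD Y) r#s
  ... | inj₁ o = o
  ... | inj₂ xy = ⊥-elim (no-xy (_ , xy))

  PathSubdivision : V → V → Set
  PathSubdivision u x = ∃ λ r₁ → ∃ λ v₀ → ∃ λ r₂ → ∃ λ w₀ → ∃ λ r₃ →
       HPathIn (InDi one) u r₁ v₀ × HPathIn InD v₀ r₂ w₀ × HPathIn (InDi two) w₀ r₃ x ×
       Unique (u ∷ r₁ ++ r₂ ++ r₃) ×
       OpenObst (colors (u ∷ r₁ ++ r₂ ++ r₃)) (length r₁) ×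
       OpenObst (colors (u ∷ r₁ ++ r₂ ++ r₃)) (length r₁ + length r₂)

  CycleSubdivision : Set
  CycleSubdivision = ∃ λ u₀ → ∃ λ r₁ → ∃ λ v₀ → ∃ λ r₂ → ∃ λ w₀ → ∃ λ r₃ →
       CycleIn InD u₀ (r₁ ++ r₂ ++ r₃) ×
       HPathIn (InDi one) u₀ r₁ v₀ × HPathIn InD v₀ r₂ w₀ × HPathIn (InDi two) w₀ r₃ u₀ ×
       ClosedObst (colors (u₀ ∷ r₁ ++ r₂ ++ r₃)) 0 ×
       ClosedObst (colors (u₀ ∷ r₁ ++ r₂ ++ r₃)) (length r₁) ×
       ClosedObst (colors (u₀ ∷ r₁ ++ r₂ ++ r₃)) (length r₁ + length r₂)

  -- A (ξ₁,ξ,ξ₂)-H-subdivision from a to b, except that its three pieces need not be disjoint.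
  record Subdivision (a b : V) : Set where
    constructor subdivision
    field
      {r₁ r₂ r₃} : List V
      {v₀ w₀} : V
      first : HPathIn (InDi one) a r₁ v₀
      middle : HPathIn InD v₀ r₂ w₀
      final : HPathIn (InDi two) w₀ r₃ b
      obstruction₁ : ObstructedAt a r₁ (r₂ ++ r₃)
      obstruction₂ : ObstructedAt a (r₁ ++ r₂) r₃

  middleSubdivision : ∀ {a b v₀ w₀ r₁ r₂ r₃} →
    HPathIn (InDi one) a r₁ v₀ → HPathIn InD v₀ r₂ w₀ → HPathIn (InDi two) w₀ r₃ b →
    ObstructedAt a r₁ (r₂ ++ r₃) → ObstructedAt v₀ r₂ r₃ → Subdivision a b
  middleSubdivision {a} {r₁ = r₁} {r₂} {r₃} X Y Z o₁ o₂ =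
    subdivision X Y Z o₁
      (obstructedAt-++ a r₁ r₂ r₃ (subst (λ v → ObstructedAt v r₂ r₃) (sym (proj₁ X)) o₂))

  asPath : ∀ {u x} (S : Subdivision u x) → let open Subdivision S in
    Disjoint (u ∷ r₁) (r₂ ++ r₃) → Disjoint r₂ r₃ → PathSubdivision u x
  asPath {u} (subdivision {r₁} {r₂} {r₃} X Y@(_ , _ ∷ u₂ , _) Z@(_ , _ ∷ u₃ , _) o₁ o₂) X#YZ Y#Z =
    r₁ , _ , r₂ , _ , r₃ , X , Y , Z , Unique.++⁺ (unique X) (Unique.++⁺ u₂ u₃ Y#Z) X#YZ ,
    o₁ , obstructedAt-++-assoc u r₁ r₂ r₃ o₂

  Separated : Set
  Separated = ∀ a b → CCArc a b → side (cls a) ≢ side (cls b) → ¬ HArc a b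

  _≟ˢ_ : (σ τ : Side) → Dec (σ ≡ τ)
  one ≟ˢ one = yes refl
  one ≟ˢ two = no λ ()
  two ≟ˢ one = no λ ()
  two ≟ˢ two = yes refl

  module _ (separated : Separated) where

    ¬HArc-crossing : ∀ {σ τ t v m} → σ ≢ τ → Arc t v × InDi σ t v → Arc v m × InDi τ v m →
      ¬ HArc (c t v) (c v m)
    ¬HArc-crossing σ≢τ (tv , refl) (vm , refl) = separated _ _ (_ , _ , _ , tv , vm , refl , refl) σ≢τ

    sameSide : ∀ {t v m} → Arc t v → Arc v m → HArc (c t v) (c v m) →
      side (cls (c t v)) ≡ side (cls (c v m))
    sameSide {t} {v} {m} tv vm turn with side (cls (c t v)) ≟ˢ side (cls (c v m))
    ... | yes eq = eq
    ... | no neq = ⊥-elim (¬HArc-crossing neq (tv , refl) (vm , refl) turn)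

    ContainedIn-sameSide : ∀ x y r → ContainedIn InD (x ∷ y ∷ r) → IsHWalk (x ∷ y ∷ r) →
      ContainedIn (InDi (side (cls (c x y)))) (x ∷ y ∷ r)
    ContainedIn-sameSide x y [] ((xy , _) ∷ []) _ = (xy , refl) ∷ []
    ContainedIn-sameSide x y (m ∷ r) ((xy , _) ∷ rest@((ym , _) ∷ _)) (turn ∷ l) =
      (xy , refl) ∷ subst (λ σ → ContainedIn (InDi σ) (y ∷ m ∷ r)) (sym (sameSide xy ym turn))
                      (ContainedIn-sameSide y m r rest l)

    HPathIn-oneSide : ∀ {x r y} → x ≢ y → HPathIn InD x r y →
      HPathIn (InDi one) x r y ⊎ HPathIn (InDi two) x r y
    HPathIn-oneSide {r = []} x≢y (end , _) = ⊥-elim (x≢y end)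
    HPathIn-oneSide {x} {y′ ∷ r} _ (end , u , a , l)
      with side (cls (c x y′)) | ContainedIn-sameSide x y′ r a l
    ... | one | a′ = inj₁ (end , u , a′ , l)
    ... | two | a′ = inj₂ (end , u , a′ , l)

    obstructedAt-crossing : ∀ {σ τ x v} → σ ≢ τ → ∀ r s → r ≢ [] → s ≢ [] → lastOf x r ≡ v →
      ContainedIn (InDi σ) (x ∷ r) → ContainedIn (InDi τ) (v ∷ s) → ObstructedAt x r s
    obstructedAt-crossing _ [] s r≢[] _ _ _ _ = ⊥-elim (r≢[] refl)
    obstructedAt-crossing _ (y ∷ r) [] _ s≢[] _ _ _ = ⊥-elim (s≢[] refl)
    obstructedAt-crossing {x = x} σ≢τ (y ∷ r) (m ∷ s) _ _ refl a₁ (vm ∷ _) with lastArc x y r a₁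
    ... | t , tv , e =
      obstructedAt-turn x y r m s (subst (λ col → ¬ HArc col _) (sym e) (¬HArc-crossing σ≢τ tv vm))

    closedObst-crossing : ∀ a y q m R → Arc a y × InDi one a y →
      ContainedIn (InDi two) (lastOf y q ∷ m ∷ R) → lastOf m R ≡ a →
      ClosedObst (colors (a ∷ y ∷ q ++ m ∷ R)) 0
    closedObst-crossing .(lastOf m R) y q m R ay Z refl with lastArc (lastOf y q) m R Z
    ... | t , ta , e =
      _ , _ , (refl , refl) ,
      subst (λ col → ¬ HArc col (c _ y)) (sym (trans (lastColour-++ _ y q m R) e))
        (¬HArc-crossing (λ ()) ta ay)

    directSubdivision : ∀ {a b v r₁ r₃} → r₁ ≢ [] → r₃ ≢ [] →
      HPathIn (InDi one) a r₁ v → HPathIn (InDi two) v r₃ b → Subdivision a b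
    directSubdivision {a} {r₁ = r₁} {r₃} r₁≢[] r₃≢[] X Z =
      subdivision X (refl , [] ∷ [] , [] , []) Z o
        (subst (λ r → ObstructedAt a r r₃) (sym (++-identityʳ r₁)) o)
      where o = obstructedAt-crossing (λ ()) r₁ r₃ r₁≢[] r₃≢[] (proj₁ X) (contained X) (contained Z)

    asCycle : ∀ {a} (S : Subdivision a a) → let open Subdivision S in
      Disjoint r₁ (r₂ ++ r₃) → Disjoint r₂ r₃ → CycleSubdivision
    asCycle (subdivision {[]} _ _ _ () _)
    asCycle (subdivision {y ∷ r₁} {r₂} {[]} _ _ _ _ o₂) = ⊥-elim (obstructedAt-[] _ ((y ∷ r₁) ++ r₂) o₂)
    asCycle {a} (subdivision {y ∷ r₁} {r₂} {m ∷ R}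
                  X@(refl , _ ∷ u₁ , a₁ , _) Y@(refl , _ ∷ u₂ , a₂ , _) Z@(end , _ ∷ u₃ , a₃ , _) o₁ o₂)
                X#YZ Y#Z =
      a , y ∷ r₁ , _ , r₂ , _ , m ∷ R ,
      ((λ ()) , closes , Unique.++⁺ u₁ (Unique.++⁺ u₂ u₃ Y#Z) X#YZ ,
        ContainedIn-++⁺ a (y ∷ r₁) (r₂ ++ m ∷ R) refl (contained (HPathIn-InD X))
          (ContainedIn-++⁺ _ r₂ (m ∷ R) refl a₂ (contained (HPathIn-InD Z)))) ,
      X , Y , Z ,
      subst (λ t → ClosedObst (colors (a ∷ y ∷ t)) 0) (++-assoc r₁ r₂ (m ∷ R))
        (closedObst-crossing a y (r₁ ++ r₂) m R (All.head a₁)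
          (subst (λ t → ContainedIn (InDi two) (t ∷ m ∷ R)) (sym (lastOf-++ y r₁ r₂)) a₃) end) ,
      openObst⇒closedObst cycle (length (y ∷ r₁)) o₁ ,
      openObst⇒closedObst cycle (length (y ∷ r₁) + length r₂)
        (obstructedAt-++-assoc a (y ∷ r₁) r₂ (m ∷ R) o₂)
      where
        cycle = colors (a ∷ y ∷ r₁ ++ r₂ ++ m ∷ R)
        closes : lastOf a (y ∷ r₁ ++ r₂ ++ m ∷ R) ≡ a
        closes = trans (lastOf-++ y r₁ (r₂ ++ m ∷ R)) (trans (lastOf-++ (lastOf y r₁) r₂ (m ∷ R)) end)

    directPath : ∀ {u y x} T G → HPathIn (InDi one) u (T ∷ʳ y) y → HPathIn (InDi two) y G x → G ≢ [] →
      Disjoint (u ∷ T) G → PathSubdivision u x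
    directPath {u} T G X Z G≢[] uT#G =
      asPath (directSubdivision (∷ʳ≢[] T _) G≢[] X Z) (Disjoint-∷ʳ {xs = u ∷ T} uT#G (start∉ Z))
        λ { (() , _) }

    directCycle : ∀ {a y} T G → HPathIn (InDi one) a (T ∷ʳ y) y → HPathIn (InDi two) y G a → G ≢ [] →
      Disjoint T G → CycleSubdivision
    directCycle T G X Z G≢[] T#G =
      asCycle (directSubdivision (∷ʳ≢[] T _) G≢[] X Z) (Disjoint-∷ʳ T#G (start∉ Z)) λ { (() , _) }

    -- For α₁ = u ∷ r, the vertex list W of α₂ and R = w ∷ ρ ending at a: X = u ∷ K is the
    -- prefix of α₁ up to p ∈ W, Y = p ∷ r₂ comes from α₂ and Z = q ∷ r₃ is a suffix of R.
    record Bridge (u : V) (r W : List V) (a : V) (ρ : List V) : Set where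
      field
        {K K′ r₂ r₃} : List V
        {p q} : V
        α₁-split : r ≡ K ++ K′
        initial : HPathIn (InDi one) u K p
        p∈W : p ∈ W
        middle : HPathIn InD p r₂ q
        final : HPathIn (InDi two) q r₃ a
        final⊆ : r₃ ⊆ ρ
        X#Y : Disjoint (u ∷ K) r₂
        Y#Z : Disjoint r₂ r₃
        obstruction-p : ObstructedAt u K (r₂ ++ r₃)
        obstruction-q : ObstructedAt p r₂ r₃

      K⊆ : K ⊆ r
      K⊆ t∈ = subst (_ ∈_) (sym α₁-split) (∈-++⁺ˡ t∈)

    -- p is the first vertex of α₁ on α₂ and q the first vertex of α₂ after p on R. Without an
    -- obstruction at p, X followed by α₂ would be a uw-H-path; at q the side changes.
    bridgeOne : ∀ {u z w a} r₁ r₂ ρ →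
      HPathIn (InDi one) u r₁ z → HPathIn (InDi one) z r₂ w → HPathIn (InDi two) w ρ a →
      ¬ ExHPath InD u w → ¬ ExHPath InD z u → ¬ ExHPath InD z a →
      (∀ {t} → t ∈ u ∷ r₁ → t ∈ z ∷ r₂ → t ∉ w ∷ ρ) → Bridge u r₁ (z ∷ r₂) a ρ
    bridgeOne {u} {z} {w} r₁ r₂ ρ α₁ α₂ R no-uw no-zu no-za α₁∩α₂∩R
      with firstIn-lastOf _≟_ (z ∷ r₂) u r₁ (∉HPathFrom no-zu α₂)
             (subst (_∈ z ∷ r₂) (sym (proj₁ α₁)) (here refl))
    ... | firstIn T p K′ T∉α₂ p∈α₂ with ∈⇒split p∈α₂
    ...   | Q₀ , Q , refl , Q₀-end
      with HPathIn-split (T ∷ʳ p) K′ (lastOf-∷ʳ u T p) α₁ | HPathIn-split Q₀ Q Q₀-end α₂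
    ...     | X , _ | _ , α₂-from-p
      with firstIn-lastOf _≟_ (w ∷ ρ) p Q (α₁∩α₂∩R (there (∈-∷ʳ-++ T K′)) p∈α₂)
             (subst (_∈ w ∷ ρ) (sym (proj₁ α₂-from-p)) (here refl))
    ...       | firstIn T₂ q Q′ T₂∉R q∈R with ∈⇒split q∈R
    ...         | ρ₀ , r₃ , refl , ρ₀-end
      with HPathIn-split (T₂ ∷ʳ q) Q′ (lastOf-∷ʳ p T₂ q) α₂-from-p | HPathIn-split ρ₀ r₃ ρ₀-end R
    ...           | Y , _ | _ , Z = record
      { α₁-split = refl
      ; initial = X
      ; p∈W = p∈α₂
      ; middle = HPathIn-InD Y
      ; final = Z
      ; final⊆ = ∈-++⁺ʳ ρ₀
      ; X#Y = Disjoint-⊆ id ∈-++⁺ˡ X#α₂-from-p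
      ; Y#Z = Disjoint-∷ʳ (Disjoint-⊆ id (there ∘ ∈-++⁺ʳ ρ₀) (All∉⇒Disjoint T₂∉R)) (start∉ Z)
      ; obstruction-p = obstructedAt-prefix u (T ∷ʳ p) (T₂ ∷ʳ q) Q′ r₃ (∷ʳ≢[] T₂ q)
                          (obstructedAt-¬ExHPath (T ∷ʳ p) _ no-uw X α₂-from-p X#α₂-from-p)
      ; obstruction-q = obstructedAt-crossing (λ ()) (T₂ ∷ʳ q) r₃ (∷ʳ≢[] T₂ q) r₃≢[] (proj₁ Y)
                          (contained Y) (contained Z)
      }
      where
        X#α₂-from-p : Disjoint (u ∷ T ∷ʳ p) ((T₂ ∷ʳ q) ++ Q′)
        X#α₂-from-p = Disjoint-∷ʳ
          (Disjoint-⊆ id (there ∘ ∈-++⁺ʳ Q₀) (All∉⇒Disjoint (∉HPathFrom no-zu α₂ ∷ T∉α₂))) (start∉ α₂-from-p)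
        r₃≢[] : r₃ ≢ []
        r₃≢[] refl = ∉HPathFrom no-za α₂
          (subst (_∈ z ∷ Q₀ ++ (T₂ ∷ʳ q) ++ Q′) (proj₁ Z) (there (∈-++⁺ʳ Q₀ (∈-∷ʳ-++ T₂ Q′))))

    -- q is the first vertex of α₂ on R and p the first vertex of α₁ on α₂ up to q. Without an
    -- obstruction at q, α₂ followed by Z would be a za-H-path; at p the side changes.
    bridgeTwo : ∀ {u z w a} r₁ r₂ ρ →
      HPathIn (InDi one) u r₁ z → HPathIn (InDi two) z r₂ w → HPathIn (InDi two) w ρ a →
      ¬ ExHPath InD z u → ¬ ExHPath InD z a →
      (∀ {t} → t ∈ u ∷ r₁ → t ∈ z ∷ r₂ → t ∉ w ∷ ρ) → Bridge u r₁ (z ∷ r₂) a ρ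
    bridgeTwo {u} {z} {w} r₁ r₂ ρ α₁ α₂ R no-zu no-za α₁∩α₂∩R
      with firstIn-lastOf _≟_ (w ∷ ρ) z r₂ (∉HPathTo no-za R)
             (subst (_∈ w ∷ ρ) (sym (proj₁ α₂)) (here refl))
    ... | firstIn T q T′ T∉R q∈R with ∈⇒split q∈R
    ...   | ρ₀ , r₃ , refl , ρ₀-end
      with HPathIn-split (T ∷ʳ q) T′ (lastOf-∷ʳ z T q) α₂ | HPathIn-split ρ₀ r₃ ρ₀-end R
    ...     | α₂-to-q , _ | _ , Z
      with firstIn-lastOf _≟_ (z ∷ T ∷ʳ q) u r₁ (∉HPathFrom no-zu α₂-to-q)
             (subst (_∈ z ∷ T ∷ʳ q) (sym (proj₁ α₁)) (here refl))
    ...       | firstIn K₀ p K′ K₀∉α₂-to-q p∈α₂-to-q with ∈⇒split p∈α₂-to-q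
    ...         | Y₀ , r₂′ , Tq-split , Y₀-end
      with HPathIn-split (K₀ ∷ʳ p) K′ (lastOf-∷ʳ u K₀ p) α₁
         | HPathIn-split Y₀ r₂′ Y₀-end (subst (λ t → HPathIn (InDi two) z t q) Tq-split α₂-to-q)
    ...           | X , _ | _ , Y = record
      { α₁-split = refl
      ; initial = X
      ; p∈W = α₂-to-q⊆α₂ p∈α₂-to-q
      ; middle = HPathIn-InD Y
      ; final = Z
      ; final⊆ = ∈-++⁺ʳ ρ₀
      ; X#Y = Disjoint-∷ʳ
                (Disjoint-⊆ id (there ∘ r₂′⊆Tq) (All∉⇒Disjoint (∉HPathFrom no-zu α₂-to-q ∷ K₀∉α₂-to-q)))
                (start∉ Y)
      ; Y#Z = Disjoint-⊆ r₂′⊆Tq id (Disjoint-∷ʳ (Disjoint-⊆ id r₃⊆R (All∉⇒Disjoint T∉R)) (start∉ Z))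
      ; obstruction-p = obstructedAt-crossing (λ ()) (K₀ ∷ʳ p) (r₂′ ++ r₃) (∷ʳ≢[] K₀ p)
                          (r₂′≢[] ∘ ++-conicalˡ r₂′ r₃) (lastOf-∷ʳ u K₀ p) (contained X)
                          (ContainedIn-++⁺ p r₂′ r₃ (proj₁ Y) (contained Y) (contained Z))
      ; obstruction-q = subst (λ v → ObstructedAt v r₂′ r₃) Y₀-end
                          (obstructedAt-drop z Y₀ r₂′ r₃ r₂′≢[] (subst (λ t → ObstructedAt z t r₃) Tq-split
                            (obstructedAt-¬ExHPath (T ∷ʳ q) r₃ no-za α₂-to-q Z α₂-to-q#Z)))
      }
      where
        r₃⊆R : r₃ ⊆ w ∷ ρ₀ ++ r₃
        r₃⊆R = there ∘ ∈-++⁺ʳ ρ₀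
        α₂-to-q#Z : Disjoint (z ∷ T ∷ʳ q) r₃
        α₂-to-q#Z = Disjoint-∷ʳ {xs = z ∷ T}
          (Disjoint-⊆ id r₃⊆R (All∉⇒Disjoint (∉HPathTo no-za R ∷ T∉R))) (start∉ Z)
        r₂′⊆Tq : r₂′ ⊆ T ∷ʳ q
        r₂′⊆Tq t∈ = subst (_ ∈_) (sym Tq-split) (∈-++⁺ʳ Y₀ t∈)
        α₂-to-q⊆α₂ : z ∷ T ∷ʳ q ⊆ z ∷ (T ∷ʳ q) ++ T′
        α₂-to-q⊆α₂ = ∷⁺ʳ z ∈-++⁺ˡ
        r₂′≢[] : r₂′ ≢ []
        r₂′≢[] refl = α₁∩α₂∩R (there (∈-∷ʳ-++ K₀ K′)) (α₂-to-q⊆α₂ p∈α₂-to-q)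
                        (subst (_∈ w ∷ ρ₀ ++ r₃) (sym (proj₁ Y)) q∈R)

    bridge : ∀ {u z w a} r₁ r₂ ρ → z ≢ w →
      HPathIn (InDi one) u r₁ z → HPathIn InD z r₂ w → HPathIn (InDi two) w ρ a →
      ¬ ExHPath InD u w → ¬ ExHPath InD z u → ¬ ExHPath InD z a →
      (∀ {t} → t ∈ u ∷ r₁ → t ∈ z ∷ r₂ → t ∉ w ∷ ρ) → Bridge u r₁ (z ∷ r₂) a ρ
    bridge r₁ r₂ ρ z≢w α₁ α₂ R no-uw no-zu no-za α₁∩α₂∩R with HPathIn-oneSide z≢w α₂
    ... | inj₁ α₂⊆D₁ = bridgeOne r₁ r₂ ρ α₁ α₂⊆D₁ R no-uw no-zu no-za α₁∩α₂∩R
    ... | inj₂ α₂⊆D₂ = bridgeTwo r₁ r₂ ρ α₁ α₂⊆D₂ R no-zu no-za α₁∩α₂∩R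

    bridgePath : ∀ {u r W x ρ} (B : Bridge u r W x ρ) → Disjoint (u ∷ Bridge.K B) (Bridge.r₃ B) →
      PathSubdivision u x
    bridgePath B X#Z =
      asPath (middleSubdivision initial middle final obstruction-p obstruction-q) (Disjoint-++ X#Y X#Z) Y#Z
      where open Bridge B

    bridgeCycle : ∀ {u r W ρ} (B : Bridge u r W u ρ) → Disjoint (Bridge.K B) (Bridge.r₃ B) →
      CycleSubdivision
    bridgeCycle B K#Z =
      asCycle (middleSubdivision initial middle final obstruction-p obstruction-q)
        (Disjoint-++ (Disjoint-⊆ there id X#Y) K#Z) Y#Z
      where open Bridge B

    cycleThroughStart : ∀ {u z x w} r₁ r₂ r₃ → z ≢ w →
      HPathIn (InDi one) u r₁ z → HPathIn InD z r₂ w → HPathIn (InDi two) w r₃ x →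
      ¬ ExHPath InD u w → ¬ ExHPath InD z u → u ∈ w ∷ r₃ → CycleSubdivision
    cycleThroughStart {u} {w = w} r₁ r₂ r₃ z≢w α₁ α₂ α₃ no-uw no-zu u∈α₃ with ∈⇒split u∈α₃
    ... | G , G′ , refl , G-end with proj₁ (HPathIn-split G G′ G-end α₃) | firstIn? _≟_ (w ∷ G) r₁
    ...   | R | inj₁ (firstIn T y P′ T∉R y∈R) with properSuffix R y∈R (∷ʳ-++-≢head T P′ (unique α₁))
    ...     | G₁ , Z , G₁⊆G , G₁≢[] =
      directCycle T G₁ (proj₁ (HPathIn-split (T ∷ʳ y) P′ (lastOf-∷ʳ u T y) α₁)) Z G₁≢[]
        (Disjoint-⊆ id (there ∘ G₁⊆G) (All∉⇒Disjoint T∉R))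
    cycleThroughStart r₁ r₂ _ z≢w α₁ α₂ _ no-uw no-zu _ | G , _ , refl , _ | R | inj₂ r₁∉R =
      bridgeCycle B (Disjoint-⊆ K⊆ (there ∘ final⊆) (All∉⇒Disjoint r₁∉R))
      where
        B = bridge r₁ r₂ G z≢w α₁ α₂ R no-uw no-zu no-zu λ where
              (here refl) t∈α₂ _ → ∉HPathFrom no-zu α₂ t∈α₂
              (there t∈r₁) _ t∈R → All.lookup r₁∉R t∈r₁ t∈R
        open Bridge B

    -- α₁ meets α₃ only at x: either X avoids x, hence α₃, or X runs through x and its part
    -- after x closes a cycle at x.
    bridgeMeetingAtEnd : ∀ {u x z W ρ} T P′ → HPathIn (InDi one) u ((T ∷ʳ x) ++ P′) z →
      All (_∉ ρ) (u ∷ T) → All (_∉ ρ) P′ → x ∉ W → (B : Bridge u ((T ∷ʳ x) ++ P′) W x ρ) →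
      PathSubdivision u x ⊎ CycleSubdivision
    bridgeMeetingAtEnd {u} {x} {W = W} T P′ α₁ uT∉ρ P′∉ρ x∉W B with x ∈? u ∷ Bridge.K B
    ... | no x∉X = inj₁ (bridgePath B λ (t∈X , t∈Z) →
                     x∉X (subst (_∈ u ∷ K) (onlyHit T x P′ uT∉ρ P′∉ρ (∷⁺ʳ u K⊆ t∈X) (final⊆ t∈Z)) t∈X))
      where open Bridge B
    ... | yes x∈X with ∈⇒split x∈X
    ...   | K₁ , M , K-split , K₁-end =
      inj₂ (asCycle (middleSubdivision X middle final obstruction-x obstruction-q)
              (Disjoint-++ M#Y M#Z) Y#Z)
      where
        open Bridge B
        α₁-split′ : (T ∷ʳ x) ++ P′ ≡ K₁ ++ (M ++ K′)
        α₁-split′ = trans α₁-split (trans (cong (_++ K′) K-split) (++-assoc K₁ M K′))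
        K₁≡Tx : K₁ ≡ T ∷ʳ x
        K₁≡Tx = sym (split-unique (T ∷ʳ x) P′ K₁ (M ++ K′) (unique α₁) α₁-split′
                       (trans (lastOf-∷ʳ u T x) (sym K₁-end)))
        M⊆P′ : M ⊆ P′
        M⊆P′ = subst (M ⊆_)
                 (++-cancelˡ (T ∷ʳ x) (M ++ K′) P′ (trans (cong (_++ (M ++ K′)) (sym K₁≡Tx)) (sym α₁-split′)))
                 ∈-++⁺ˡ
        M⊆K : M ⊆ K
        M⊆K = subst (M ⊆_) (sym K-split) (∈-++⁺ʳ K₁)
        M≢[] : M ≢ []
        M≢[] refl = x∉W (subst (_∈ W) p≡x p∈W)
          where
            p≡x = trans (sym (proj₁ initial)) (trans (cong (lastOf u) K-split) (trans (lastOf-++ u K₁ []) K₁-end))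
        X : HPathIn (InDi one) x M p
        X = proj₂ (HPathIn-split K₁ M K₁-end (subst (λ k → HPathIn (InDi one) u k p) K-split initial))
        obstruction-x : ObstructedAt x M (r₂ ++ r₃)
        obstruction-x = subst (λ v → ObstructedAt v M (r₂ ++ r₃)) K₁-end
                          (obstructedAt-drop u K₁ M (r₂ ++ r₃) M≢[]
                            (subst (λ k → ObstructedAt u k (r₂ ++ r₃)) K-split obstruction-p))
        M#Y : Disjoint M r₂
        M#Y = Disjoint-⊆ (there ∘ M⊆K) id X#Y
        M#Z : Disjoint M r₃
        M#Z (t∈M , t∈Z) = All.lookup P′∉ρ (M⊆P′ t∈M) (final⊆ t∈Z)

    firstMeetingAtEnd : ∀ {u z x w} T P′ r₂ r₃ → z ≢ w →
      HPathIn (InDi one) u ((T ∷ʳ x) ++ P′) z → HPathIn InD z r₂ w → HPathIn (InDi two) w r₃ x →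
      ¬ ExHPath InD u w → ¬ ExHPath InD z x → ¬ ExHPath InD z u → All (_∉ w ∷ r₃) (u ∷ T) →
      PathSubdivision u x ⊎ CycleSubdivision
    firstMeetingAtEnd {u} {x = x} {w} T P′ r₂ r₃ z≢w α₁ α₂ α₃ no-uw no-zx no-zu uT∉α₃
      with proj₂ (HPathIn-split (T ∷ʳ x) P′ (lastOf-∷ʳ u T x) α₁) | firstIn? _≟_ (w ∷ r₃) P′
    ... | α₁-from-x | inj₁ (firstIn T₂ y P″ T₂∉α₃ y∈α₃)
      with properSuffix α₃ y∈α₃ (∷ʳ-++-≢head T₂ P″ (unique α₁-from-x))
    ...   | G , Z , G⊆r₃ , G≢[] =
      inj₂ (directCycle T₂ G (proj₁ (HPathIn-split (T₂ ∷ʳ y) P″ (lastOf-∷ʳ x T₂ y) α₁-from-x)) Z G≢[]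
              (Disjoint-⊆ id (there ∘ G⊆r₃) (All∉⇒Disjoint T₂∉α₃)))
    firstMeetingAtEnd {z = z} {x} T P′ r₂ r₃ z≢w α₁ α₂ α₃ no-uw no-zx no-zu uT∉α₃ | _ | inj₂ P′∉α₃ =
      bridgeMeetingAtEnd T P′ α₁ (All.map (_∘ there) uT∉α₃) (All.map (_∘ there) P′∉α₃) (∉HPathFrom no-zx α₂)
        (bridge _ r₂ r₃ z≢w α₁ α₂ α₃ no-uw no-zu no-zx λ t∈α₁ t∈α₂ t∈α₃ →
          ∉HPathFrom no-zx α₂ (subst (_∈ z ∷ r₂) (onlyHit T x P′ uT∉α₃ P′∉α₃ t∈α₁ t∈α₃) t∈α₂))

    subdivisionExists : ∀ {u z x w} r₁ r₂ r₃ → z ≢ w →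
      HPathIn (InDi one) u r₁ z → HPathIn InD z r₂ w → HPathIn (InDi two) w r₃ x →
      ¬ ExHPath InD u w → ¬ ExHPath InD z x → ¬ ExHPath InD z u →
      PathSubdivision u x ⊎ CycleSubdivision
    subdivisionExists {u} {x = x} {w} r₁ r₂ r₃ z≢w α₁ α₂ α₃ no-uw no-zx no-zu with u ∈? w ∷ r₃
    ... | yes u∈α₃ = inj₂ (cycleThroughStart r₁ r₂ r₃ z≢w α₁ α₂ α₃ no-uw no-zu u∈α₃)
    ... | no u∉α₃ with firstIn? _≟_ (w ∷ r₃) r₁
    ...   | inj₂ r₁∉α₃ =
      inj₁ (bridgePath B (Disjoint-⊆ (∷⁺ʳ u K⊆) (there ∘ final⊆) (All∉⇒Disjoint (u∉α₃ ∷ r₁∉α₃))))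
      where
        B = bridge r₁ r₂ r₃ z≢w α₁ α₂ α₃ no-uw no-zu no-zx λ t∈α₁ _ → All.lookup (u∉α₃ ∷ r₁∉α₃) t∈α₁
        open Bridge B
    ...   | inj₁ (firstIn T y P′ T∉α₃ y∈α₃) with y ≟ x
    ...     | yes refl = firstMeetingAtEnd T P′ r₂ r₃ z≢w α₁ α₂ α₃ no-uw no-zx no-zu (u∉α₃ ∷ T∉α₃)
    ...     | no y≢x with properSuffix α₃ y∈α₃ y≢x
    ...       | G , Z , G⊆r₃ , G≢[] =
      inj₁ (directPath T G (proj₁ (HPathIn-split (T ∷ʳ y) P′ (lastOf-∷ʳ u T y) α₁)) Z G≢[]
              (Disjoint-⊆ id (there ∘ G⊆r₃) (All∉⇒Disjoint (u∉α₃ ∷ T∉α₃))))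

-- Only condition (4), z ≢ w and the three missing H-paths are needed.
mainTheorem10 :
    {n h k : ℕ}
    (DA : Fin n → Fin n → Bool) (HA : Fin h → Fin h → Bool)
    (c : Fin n → Fin n → Fin h) (cls : Fin h → Fin k) (side : Fin k → Side) →
    let open Setting DA HA c cls side in
    (∀ v → DA v v ≡ false) →
    (∀ v → ∃ λ u → Arc u v ⊎ Arc v u) →
    2 ≤ k →
    (∀ m → ∃ λ u → ∃ λ v → Arc u v × InG m u v) →
    (∀ m → TransByHPaths (InG m)) →
    (∃ λ m → side m ≡ one) →
    (∃ λ m → side m ≡ two) →
    (u z x w : V) →
    u ≢ z → u ≢ w → z ≢ x → z ≢ w → x ≢ w →
    (∀ s y rest → CycleIn (InDi s) y rest →
       ∃ λ m → side m ≡ s × ContainedIn (InG m) (y ∷ rest)) →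
    (∀ s y rest → IsHWalk (y ∷ rest) → ContainedIn (InDi s) (y ∷ rest) →
       ∃ λ m → side m ≡ s × ContainedIn (InG m) (y ∷ rest)) →
    (∃ λ r₁ → ∃ λ r₂ → ∃ λ r₃ →
       HPathIn (InDi one) u r₁ z × HPathIn InD z r₂ w × HPathIn (InDi two) w r₃ x ×
       OpenObst (colors (u ∷ r₁ ++ r₂ ++ r₃)) (length r₁) ×
       OpenObst (colors (u ∷ r₁ ++ r₂ ++ r₃)) (length r₁ + length r₂)) →
    (∀ a b → CCArc a b → side (cls a) ≢ side (cls b) → ¬ HArc a b) →
    ¬ ExHPath InD u w →
    ¬ ExHPath InD z x →
    ¬ ExHPath InD z u →
    (∃ λ r₁ → ∃ λ v₀ → ∃ λ r₂ → ∃ λ w₀ → ∃ λ r₃ →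
       HPathIn (InDi one) u r₁ v₀ × HPathIn InD v₀ r₂ w₀ × HPathIn (InDi two) w₀ r₃ x ×
       Unique (u ∷ r₁ ++ r₂ ++ r₃) ×
       OpenObst (colors (u ∷ r₁ ++ r₂ ++ r₃)) (length r₁) ×
       OpenObst (colors (u ∷ r₁ ++ r₂ ++ r₃)) (length r₁ + length r₂))
    ⊎
    (∃ λ u₀ → ∃ λ r₁ → ∃ λ v₀ → ∃ λ r₂ → ∃ λ w₀ → ∃ λ r₃ →
       CycleIn InD u₀ (r₁ ++ r₂ ++ r₃) ×
       HPathIn (InDi one) u₀ r₁ v₀ × HPathIn InD v₀ r₂ w₀ × HPathIn (InDi two) w₀ r₃ u₀ ×
       ClosedObst (colors (u₀ ∷ r₁ ++ r₂ ++ r₃)) 0 ×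
       ClosedObst (colors (u₀ ∷ r₁ ++ r₂ ++ r₃)) (length r₁) ×
       ClosedObst (colors (u₀ ∷ r₁ ++ r₂ ++ r₃)) (length r₁ + length r₂))
mainTheorem10 DA HA c cls side _ _ _ _ _ _ _ u z x w _ _ _ z≢w _ _ _ (r₁ , r₂ , r₃ , α₁ , α₂ , α₃ , _)
  separated no-uw no-zx no-zu =
  subdivisionExists DA HA c cls side separated r₁ r₂ r₃ z≢w α₁ α₂ α₃ no-uw no-zx no-zu
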